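{- For integers $m,n\ge0$ and $k\ge2$, let $a_{k,n}^{(m)}$ be the number of compositions of $n$ having exactly $m$ parts not congruent to $1$ modulo $k$, each of which is greater than $k$ (with $a_{k,0}^{(0)}=1$ and $a_{k,0}^{(m)}=0$ for $m\ge1$). Then, as formal power series, \[ \sum_{m,n\ge0} a^{(m)}_{k,n} x^n y^m = \frac{1-x^k}{1-x-x^k-(x^{k+2}+x^{k+3}+\cdots+x^{2k})y}. \]
   Context: A composition of $n$ is a finite sequence of positive integers summing to $n$; its entries are its parts. The empty sequence is the unique composition of $0$. -}

module Defs where

open import Data.Nat using (ℕ; zero; suc; _+_; _∸_; _≡ᵇ_; _<ᵇ_)
open import Data.Nat.Divisibility using (_∣?_)
open import Data.Bool using (Bool; true; false; _∧_; _∨_; not; if_then_else_)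
open import Data.List using (List; []; _∷_; [_]; map; concatMap; upTo; length; filterᵇ; foldr)
open import Data.Integer as ℤ using (ℤ; +_)
open import Relation.Nullary using (does)

-- compsF f n : all compositions of n (lists of positive integers summing
-- to n), enumerated by choosing the first part p ∈ {1,…,n}; f is fuel,
-- and fuel n suffices since every part is ≥ 1.
compsF : ℕ → ℕ → List (List ℕ)
compsF _       zero    = [ [] ]
compsF zero    (suc n) = []
compsF (suc f) (suc n) =
  concatMap (λ p → map (p ∷_) (compsF f (suc n ∸ p))) (map suc (upTo (suc n)))

compositions : ℕ → List (List ℕ)
compositions n = compsF n n

≡1mod : ℕ → ℕ → Bool
≡1mod k p = does (k ∣? (p ∸ 1))

allowed : ℕ → List ℕ → Bool
allowed k []      = true
allowed k (p ∷ c) = (≡1mod k p ∨ (k <ᵇ p)) ∧ allowed k c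

numNot1 : ℕ → List ℕ → ℕ
numNot1 k c = length (filterᵇ (λ p → not (≡1mod k p)) c)

a : ℕ → ℕ → ℕ → ℕ
a k n m = length (filterᵇ (λ c → allowed k c ∧ (numNot1 k c ≡ᵇ m)) (compositions n))

-- Formal power series in x, y over ℤ:  F n m = coefficient of x^n y^m

Series : Set
Series = ℕ → ℕ → ℤ

Σ≤ : ℕ → (ℕ → ℤ) → ℤ
Σ≤ zero    f = f 0
Σ≤ (suc n) f = Σ≤ n f ℤ.+ f (suc n)

_⊛_ : Series → Series → Series
(F ⊛ G) n m = Σ≤ n λ i → Σ≤ m λ j → F i j ℤ.* G (n ∸ i) (m ∸ j)

_⊕_ : Series → Series → Series
(F ⊕ G) n m = F n m ℤ.+ G n m

_⊖_ : Series → Series → Series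
(F ⊖ G) n m = F n m ℤ.- G n m

infixl 7 _⊛_
infixl 6 _⊕_ _⊖_

zeroS : Series
zeroS _ _ = + 0

sumS : List Series → Series
sumS = foldr _⊕_ zeroS

mono : ℕ → ℕ → Series
mono i j n m = if (i ≡ᵇ n) ∧ (j ≡ᵇ m) then + 1 else + 0

genA : ℕ → Series
genA k n m = + a k n m

numer : ℕ → Series
numer k = mono 0 0 ⊖ mono k 0

denom : ℕ → Series
denom k = mono 0 0 ⊖ mono 1 0 ⊖ mono k 0
        ⊖ sumS (map (λ i → mono (k + 2 + i) 1) (upTo (k ∸ 1)))

-- Splitting off the first part p of a composition gives
--   a_{n+1} = Σ_{p=1}^{n+1} w(p) · a_{n+1-p}      (a-rec),
-- where the weight w(p) is 1 if p ≡ 1 (mod k), y if p ≢ 1 and p > k, and 0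
-- otherwise.  Hence w(1) = 1, w(2) = ⋯ = w(k) = 0, and w(p + k) = w(p) except
-- for 2 ≤ p ≤ k, where w(p + k) = y.  This yields a_{n+1} = a_n for n < k
-- (a-flat) and a_{k+n+1} = a_{k+n} + a_{n+1} + y (a_{n-1} + ⋯ + a_{n-k+1})
-- (a-step), with terms of negative index omitted.
--
-- Convolution with a monomial x^i y^j is a shift and convolution is
-- linear, so the coefficient of x^n y^m in A · denom k is explicit
-- (denom-coefficient).  Comparing it with 1 - x^k in the degrees n < k,
-- n = k and n > k using a-flat and a-step proves the theorem.
module Submission where

open import Data.Nat using (ℕ; _≤_)
open import Relation.Binary.PropositionalEquality using (_≡_)
open import Defs

open import Data.Bool using (Bool; true; false; _∧_; if_then_else_)
open import Data.Bool.Properties using (T?; ∧-zeroʳ)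
open import Data.Integer using (ℤ; +_) renaming (_+_ to _+ℤ_; _-_ to _-ℤ_; _*_ to _*ℤ_)
import Data.Integer.Properties as ℤ
open import Data.Integer.Tactic.RingSolver using (solve-∀)
open import Data.List using (List; []; _∷_; _++_; map; concat; upTo; applyUpTo; length; filterᵇ)
open import Data.List.Properties using (length-++; filter-++; map-∘; map-cong; map-upTo)
open import Data.Nat
open import Data.Nat.Properties
open import Algebra.Properties.CommutativeSemigroup +-commutativeSemigroup using () renaming (interchange to +-interchange)
open import Data.Nat.Divisibility using (_∣?_; _∣0; ∣-refl; ∣⇒≤; ∣m∣n⇒∣m+n; ∣m+n∣m⇒∣n)
open import Data.Nat.ListAction using (sum)
open import Function using (_∘_)
open import Relation.Binary.PropositionalEquality using (_≢_; refl; cong; cong₂; sym; trans; subst; module ≡-Reasoning)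
open import Relation.Nullary.Decidable using (dec-true; dec-false; yes; no)

-- Σ< n f = f 0 + f 1 + ⋯ + f (n - 1).  Since sum and applyUpTo compute,
-- Σ< (suc n) f reduces to f 0 + Σ< n (f ∘ suc).
Σ< : ℕ → (ℕ → ℕ) → ℕ
Σ< n f = sum (applyUpTo f n)

Σ<-cong : ∀ n {f g : ℕ → ℕ} → (∀ i → f i ≡ g i) → Σ< n f ≡ Σ< n g
Σ<-cong zero    f≗g = refl
Σ<-cong (suc n) f≗g = cong₂ _+_ (f≗g 0) (Σ<-cong n (f≗g ∘ suc))

Σ<-+ : ∀ n (f g : ℕ → ℕ) → Σ< n (λ i → f i + g i) ≡ Σ< n f + Σ< n g
Σ<-+ zero    f g = refl
Σ<-+ (suc n) f g = trans (cong (λ s → f 0 + g 0 + s) (Σ<-+ n (f ∘ suc) (g ∘ suc)))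
                         (+-interchange (f 0) (g 0) (Σ< n (f ∘ suc)) (Σ< n (g ∘ suc)))

Σ<-zero : ∀ n (f : ℕ → ℕ) → (∀ i → i < n → f i ≡ 0) → Σ< n f ≡ 0
Σ<-zero zero    f f≡0 = refl
Σ<-zero (suc n) f f≡0 = cong₂ _+_ (f≡0 0 z<s) (Σ<-zero n (f ∘ suc) (λ i i<n → f≡0 (suc i) (s<s i<n)))

Σ<-split : ∀ j n (f : ℕ → ℕ) → Σ< (j + n) f ≡ Σ< j f + Σ< n (λ i → f (j + i))
Σ<-split zero    n f = refl
Σ<-split (suc j) n f = trans (cong (λ s → f 0 + s) (Σ<-split j n (f ∘ suc))) (sym (+-assoc (f 0) _ _))

Σ<-truncate : ∀ a b (h : ℕ → ℕ) → Σ< a (λ i → if i <ᵇ b then h i else 0) ≡ Σ< (a ⊓ b) h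
Σ<-truncate zero    b       h = refl
Σ<-truncate (suc a) zero    h = Σ<-zero a _ (λ _ _ → refl)
Σ<-truncate (suc a) (suc b) h = cong (λ s → h 0 + s) (Σ<-truncate a b (h ∘ suc))

Σ<-truncate-swap : ∀ a b (h : ℕ → ℕ) →
  Σ< a (λ i → if i <ᵇ b then h i else 0) ≡ Σ< b (λ i → if i <ᵇ a then h i else 0)
Σ<-truncate-swap a b h = begin
  Σ< a (λ i → if i <ᵇ b then h i else 0) ≡⟨ Σ<-truncate a b h ⟩
  Σ< (a ⊓ b) h                           ≡⟨ cong (λ c → Σ< c h) (⊓-comm a b) ⟩
  Σ< (b ⊓ a) h                           ≡⟨ Σ<-truncate b a h ⟨
  Σ< b (λ i → if i <ᵇ a then h i else 0) ∎
  where open ≡-Reasoning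

count : {A : Set} → (A → Bool) → List A → ℕ
count P xs = length (filterᵇ P xs)

count-++ : {A : Set} (P : A → Bool) (xs ys : List A) →
           count P (xs ++ ys) ≡ count P xs + count P ys
count-++ P xs ys = trans (cong length (filter-++ (T? ∘ P) xs ys)) (length-++ (filterᵇ P xs))

count-concat : {A : Set} (P : A → Bool) (xss : List (List A)) →
               count P (concat xss) ≡ sum (map (count P) xss)
count-concat P []         = refl
count-concat P (xs ∷ xss) = trans (count-++ P xs (concat xss)) (cong (λ s → count P xs + s) (count-concat P xss))

count-map : {A B : Set} (P : B → Bool) (f : A → B) (xs : List A) →
            count P (map f xs) ≡ count (P ∘ f) xs
count-map P f []       = refl
count-map P f (x ∷ xs) with P (f x)
... | true  = cong suc (count-map P f xs)
... | false = count-map P f xs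

count-cong : {A : Set} {P Q : A → Bool} → (∀ x → P x ≡ Q x) → (xs : List A) → count P xs ≡ count Q xs
count-cong P≗Q []       = refl
count-cong {Q = Q} P≗Q (x ∷ xs) rewrite P≗Q x with ih ← count-cong P≗Q xs | Q x
... | true  = cong suc ih
... | false = ih

count-false : {A : Set} (xs : List A) → count (λ _ → false) xs ≡ 0
count-false []       = refl
count-false (x ∷ xs) = count-false xs

-- The enumeration compsF f n does not depend on the fuel f once f ≥ n:
-- after the first part suc i, only n ∸ i ≤ n remains to be composed.
compsF-fuel : ∀ {f g n} → n ≤ f → n ≤ g → compsF f n ≡ compsF g n
compsF-fuel {n = zero} _ _ = refl
compsF-fuel {suc f} {suc g} {suc n} (s≤s n≤f) (s≤s n≤g) = cong concat (begin
    map (prefix f) (map suc (upTo (suc n)))   ≡⟨ map-∘ (upTo (suc n)) ⟨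
    map (prefix f ∘ suc) (upTo (suc n))       ≡⟨ map-cong same-tails (upTo (suc n)) ⟩
    map (prefix g ∘ suc) (upTo (suc n))       ≡⟨ map-∘ (upTo (suc n)) ⟩
    map (prefix g) (map suc (upTo (suc n)))   ∎)
  where
  open ≡-Reasoning
  prefix : ℕ → ℕ → List (List ℕ)
  prefix h p = map (p ∷_) (compsF h (suc n ∸ p))
  same-tails : ∀ i → prefix f (suc i) ≡ prefix g (suc i)
  same-tails i = cong (map (suc i ∷_))
    (compsF-fuel (≤-trans (m∸n≤m n i) n≤f) (≤-trans (m∸n≤m n i) n≤g))

hasShape : ℕ → ℕ → List ℕ → Bool
hasShape k m c = allowed k c ∧ (numNot1 k c ≡ᵇ m)

-- Multiplication by y of a sequence indexed by the y-degree.
yShift : (ℕ → ℕ) → ℕ → ℕ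
yShift F zero    = 0
yShift F (suc m) = F m

-- The weight of a first part p: given the counts F j of the admissible
-- tails with j parts ≢ 1 (mod k), the number of admissible compositions
-- p ∷ c with m such parts.  A part ≡ 1 keeps m, a part ≢ 1 must exceed k
-- and raises m by one.
firstPart : ℕ → ℕ → (ℕ → ℕ) → ℕ → ℕ
firstPart k p F m = if ≡1mod k p then F m else if k <ᵇ p then yShift F m else 0

-- The predicate on the tail c equivalent to hasShape k m (p ∷ c), where
-- b₁ and b₂ stand for "p ≡ 1 (mod k)" and "k < p".
tailShape : ℕ → Bool → Bool → ℕ → List ℕ → Bool
tailShape k true  _     m       = hasShape k m
tailShape k false false m       = λ _ → false
tailShape k false true  zero    = λ _ → false
tailShape k false true  (suc j) = hasShape k j

hasShape-cons : ∀ k m p c → hasShape k m (p ∷ c) ≡ tailShape k (≡1mod k p) (k <ᵇ p) m c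
hasShape-cons k m p c with ≡1mod k p | k <ᵇ p | m
... | true  | _     | _     = refl
... | false | false | _     = refl
... | false | true  | zero  = ∧-zeroʳ (allowed k c)
... | false | true  | suc j = refl

count-tailShape : ∀ k b₁ b₂ m (L : List (List ℕ)) → let F = λ j → count (hasShape k j) L in
  count (tailShape k b₁ b₂ m) L ≡ (if b₁ then F m else if b₂ then yShift F m else 0)
count-tailShape k true  _     m       L = refl
count-tailShape k false false m       L = count-false L
count-tailShape k false true  zero    L = count-false L
count-tailShape k false true  (suc j) L = refl

count-prefix : ∀ k p m (L : List (List ℕ)) →
  count (hasShape k m) (map (p ∷_) L) ≡ firstPart k p (λ j → count (hasShape k j) L) m
count-prefix k p m L = begin
  count (hasShape k m) (map (p ∷_) L)          ≡⟨ count-map (hasShape k m) (p ∷_) L ⟩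
  count (hasShape k m ∘ (p ∷_)) L              ≡⟨ count-cong (hasShape-cons k m p) L ⟩
  count (tailShape k (≡1mod k p) (k <ᵇ p) m) L ≡⟨ count-tailShape k (≡1mod k p) (k <ᵇ p) m L ⟩
  firstPart k p (λ j → count (hasShape k j) L) m ∎
  where open ≡-Reasoning

a-rec : ∀ k n m → a k (suc n) m ≡ Σ< (suc n) (λ i → firstPart k (suc i) (a k (n ∸ i)) m)
a-rec k n m = begin
  count P (concat (map prefix (map suc (upTo (suc n)))))
    ≡⟨ count-concat P (map prefix (map suc (upTo (suc n)))) ⟩
  sum (map (count P) (map prefix (map suc (upTo (suc n)))))
    ≡⟨ cong sum (trans (map-∘ (upTo (suc n))) (cong (map (count P)) (map-∘ (upTo (suc n))))) ⟨
  sum (map (count P ∘ prefix ∘ suc) (upTo (suc n)))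
    ≡⟨ cong sum (map-upTo (count P ∘ prefix ∘ suc) (suc n)) ⟩
  Σ< (suc n) (count P ∘ prefix ∘ suc)
    ≡⟨ Σ<-cong (suc n) tails ⟩
  Σ< (suc n) (λ i → firstPart k (suc i) (a k (n ∸ i)) m) ∎
  where
  open ≡-Reasoning
  P : List ℕ → Bool
  P = hasShape k m
  prefix : ℕ → List (List ℕ)
  prefix p = map (p ∷_) (compsF n (suc n ∸ p))
  tails : ∀ i → count P (prefix (suc i)) ≡ firstPart k (suc i) (a k (n ∸ i)) m
  tails i rewrite compsF-fuel {n} {n ∸ i} (m∸n≤m n i) ≤-refl = count-prefix k (suc i) m (compositions (n ∸ i))

≡1mod-one : ∀ k → ≡1mod k 1 ≡ true
≡1mod-one k = dec-true (k ∣? 0) (k ∣0)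

≡1mod-small : ∀ k q → 2 + q ≤ k → ≡1mod k (2 + q) ≡ false
≡1mod-small k q 2+q≤k = dec-false (k ∣? suc q) (λ k∣1+q → <⇒≱ 2+q≤k (∣⇒≤ k∣1+q))

≡1mod-periodic : ∀ k q → ≡1mod k (k + suc q) ≡ ≡1mod k (suc q)
≡1mod-periodic k q rewrite +-∸-assoc k {suc q} {1} (s≤s z≤n) with k ∣? q
... | yes k∣q = dec-true (k ∣? (k + q)) (∣m∣n⇒∣m+n ∣-refl k∣q)
... | no  k∤q = dec-false (k ∣? (k + q)) (λ k∣k+q → k∤q (∣m+n∣m⇒∣n k∣k+q ∣-refl))

firstPart-one : ∀ k F m → firstPart k 1 F m ≡ F m
firstPart-one k F m rewrite ≡1mod-one k = refl

firstPart-small : ∀ k q F m → 2 + q ≤ k → firstPart k (2 + q) F m ≡ 0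
firstPart-small k q F m 2+q≤k
  rewrite ≡1mod-small k q 2+q≤k | dec-false (k <? 2 + q) (≤⇒≯ 2+q≤k) = refl

firstPart-large : ∀ k p F m → k < p → firstPart k p F m ≡ (if ≡1mod k p then F m else yShift F m)
firstPart-large k p F m k<p rewrite dec-true (k <? p) k<p = refl

-- Periodicity of the weights: adding k to a part p changes its weight only
-- for 2 ≤ p ≤ k, where the weight 0 becomes y.
firstPart-shifted : ∀ k q F m → firstPart k (k + suc q) F m ≡ (if ≡1mod k (suc q) then F m else yShift F m)
firstPart-shifted k q F m = begin
  firstPart k (k + suc q) F m                         ≡⟨ firstPart-large k (k + suc q) F m (m<m+n k z<s) ⟩
  (if ≡1mod k (k + suc q) then F m else yShift F m)   ≡⟨ cong (λ b → if b then F m else yShift F m) (≡1mod-periodic k q) ⟩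
  (if ≡1mod k (suc q) then F m else yShift F m)       ∎
  where open ≡-Reasoning

firstPart-period-one : ∀ k F m → firstPart k (k + 1) F m ≡ F m
firstPart-period-one k F m rewrite firstPart-shifted k 0 F m | ≡1mod-one k = refl

firstPart-period : ∀ k₁ i F m → let k = suc k₁ in
  firstPart k (k + (2 + i)) F m ≡ firstPart k (2 + i) F m + (if i <ᵇ k₁ then yShift F m else 0)
firstPart-period k₁ i F m rewrite firstPart-shifted (suc k₁) (suc i) F m with i <? k₁
... | yes i<k₁ rewrite dec-true (i <? k₁) i<k₁ | ≡1mod-small (suc k₁) i (s≤s i<k₁)
                     | dec-false (k₁ <? suc i) (≤⇒≯ i<k₁) = refl
... | no  i≮k₁ rewrite dec-false (i <? k₁) i≮k₁ | dec-true (k₁ <? suc i) (s≤s (≮⇒≥ i≮k₁)) = sym (+-identityʳ _)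

module _ (k₁ : ℕ) where
  private
    k : ℕ
    k = suc k₁

  -- For 1 ≤ n + 1 ≤ k the only admissible first part is 1.
  a-flat : ∀ n m → suc n ≤ k → a k (suc n) m ≡ a k n m
  a-flat n m n<k = begin
    a k (suc n) m
      ≡⟨ a-rec k n m ⟩
    firstPart k 1 (a k n) m + Σ< n (λ i → firstPart k (2 + i) (a k (n ∸ suc i)) m)
      ≡⟨ cong₂ _+_ (firstPart-one k (a k n) m) (Σ<-zero n _ small) ⟩
    a k n m + 0
      ≡⟨ +-identityʳ _ ⟩
    a k n m ∎
    where
    open ≡-Reasoning
    small : ∀ i → i < n → firstPart k (2 + i) (a k (n ∸ suc i)) m ≡ 0
    small i i<n = firstPart-small k i _ m (≤-trans (s≤s i<n) n<k)

  -- The coefficient recurrence behind the denominator: for N = k + n + 1,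
  -- a_N = a_{N-1} + a_{N-k} + y·(a_{N-k-2} + ⋯ + a_{N-2k}).
  a-step : ∀ n m → a k (k + suc n) m ≡
    a k (k + n) m + a k (suc n) m + Σ< k₁ (λ i → if i <ᵇ n then yShift (a k (n ∸ suc i)) m else 0)
  a-step n m = begin
    a k (k + suc n) m
      ≡⟨ cong (λ N → a k N m) (+-suc k n) ⟩
    a k (suc (k + n)) m
      ≡⟨ a-rec k (k + n) m ⟩
    Σ< (suc (k + n)) G
      ≡⟨ cong (λ N → Σ< N G) (+-suc k n) ⟨
    Σ< (k + suc n) G
      ≡⟨ Σ<-split k (suc n) G ⟩
    Σ< k G + Σ< (suc n) (λ i → G (k + i))
      ≡⟨ cong₂ _+_ first-block second-block ⟩
    a k (k + n) m + (a k (suc n) m + Σ< k₁ E)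
      ≡⟨ +-assoc (a k (k + n) m) _ _ ⟨
    a k (k + n) m + a k (suc n) m + Σ< k₁ E ∎
    where
    open ≡-Reasoning
    G : ℕ → ℕ
    G i = firstPart k (suc i) (a k (k + n ∸ i)) m
    -- the new contributions y·a_{n-1-i} of the parts k + 2 + i
    E : ℕ → ℕ
    E i = if i <ᵇ n then yShift (a k (n ∸ suc i)) m else 0
    -- the parts 1, …, k: only the part 1 contributes
    first-block : Σ< k G ≡ a k (k + n) m
    first-block = trans (cong₂ _+_ (firstPart-one k (a k (k + n)) m)
                                   (Σ<-zero k₁ (G ∘ suc) (λ i i<k₁ → firstPart-small k i _ m (s≤s i<k₁))))
                        (+-identityʳ _)
    G-shift : ∀ i → G (k + i) ≡ firstPart k (k + suc i) (a k (n ∸ i)) m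
    G-shift i = cong₂ (λ p r → firstPart k p (a k r) m) (sym (+-suc k i)) ([m+n]∸[m+o]≡n∸o k n i)
    H E′ : ℕ → ℕ
    H i  = firstPart k (2 + i) (a k (n ∸ suc i)) m
    E′ i = if i <ᵇ k₁ then yShift (a k (n ∸ suc i)) m else 0
    second-block : Σ< (suc n) (λ i → G (k + i)) ≡ a k (suc n) m + Σ< k₁ E
    second-block = begin
      Σ< (suc n) (λ i → G (k + i))
        ≡⟨ Σ<-cong (suc n) G-shift ⟩
      firstPart k (k + 1) (a k n) m + Σ< n (λ i → firstPart k (k + (2 + i)) (a k (n ∸ suc i)) m)
        ≡⟨ cong₂ _+_ (firstPart-period-one k (a k n) m)
                     (Σ<-cong n (λ i → firstPart-period k₁ i (a k (n ∸ suc i)) m)) ⟩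
      a k n m + Σ< n (λ i → H i + E′ i)
        ≡⟨ cong (λ s → a k n m + s) (Σ<-+ n H E′) ⟩
      a k n m + (Σ< n H + Σ< n E′)
        ≡⟨ +-assoc (a k n m) _ _ ⟨
      a k n m + Σ< n H + Σ< n E′
        ≡⟨ cong₂ _+_ (trans (a-rec k n m) (cong (_+ Σ< n H) (firstPart-one k (a k n) m)))
                     (Σ<-truncate-swap k₁ n _) ⟨
      a k (suc n) m + Σ< k₁ E ∎

Σℤ< : ℕ → (ℕ → ℤ) → ℤ
Σℤ< zero    f = + 0
Σℤ< (suc n) f = f 0 +ℤ Σℤ< n (f ∘ suc)

Σℤ<-cong : ∀ n {f g : ℕ → ℤ} → (∀ i → f i ≡ g i) → Σℤ< n f ≡ Σℤ< n g
Σℤ<-cong zero    f≗g = refl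
Σℤ<-cong (suc n) f≗g = cong₂ _+ℤ_ (f≗g 0) (Σℤ<-cong n (f≗g ∘ suc))

Σℤ<-zero : ∀ n → Σℤ< n (λ _ → + 0) ≡ + 0
Σℤ<-zero zero    = refl
Σℤ<-zero (suc n) = trans (ℤ.+-identityˡ _) (Σℤ<-zero n)

Σℤ<-pos : ∀ n f → Σℤ< n (λ i → + f i) ≡ + Σ< n f
Σℤ<-pos zero    f = refl
Σℤ<-pos (suc n) f = trans (cong (λ s → + f 0 +ℤ s) (Σℤ<-pos n (f ∘ suc))) (sym (ℤ.pos-+ (f 0) _))

Σ≤-cong : ∀ n {f g : ℕ → ℤ} → (∀ i → f i ≡ g i) → Σ≤ n f ≡ Σ≤ n g
Σ≤-cong zero    f≗g = f≗g 0
Σ≤-cong (suc n) f≗g = cong₂ _+ℤ_ (Σ≤-cong n f≗g) (f≗g (suc n))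

Σ≤-zero : ∀ n (f : ℕ → ℤ) → (∀ i → i ≤ n → f i ≡ + 0) → Σ≤ n f ≡ + 0
Σ≤-zero zero    f f≡0 = f≡0 0 z≤n
Σ≤-zero (suc n) f f≡0 = cong₂ _+ℤ_ (Σ≤-zero n f (λ i i≤n → f≡0 i (m≤n⇒m≤1+n i≤n))) (f≡0 (suc n) ≤-refl)

Σ≤-single : ∀ n i₀ (f : ℕ → ℤ) → i₀ ≤ n → (∀ i → i ≤ n → i ≢ i₀ → f i ≡ + 0) → Σ≤ n f ≡ f i₀
Σ≤-single zero    .0 f z≤n  _    = refl
Σ≤-single (suc n) i₀ f i₀≤n others with i₀ ≟ suc n
... | yes refl = trans (cong (_+ℤ f (suc n)) (Σ≤-zero n f (λ i i≤n → others i (m≤n⇒m≤1+n i≤n) (<⇒≢ (s≤s i≤n)))))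
                       (ℤ.+-identityˡ _)
... | no  i₀≢n = trans (cong₂ _+ℤ_ (Σ≤-single n i₀ f (≤-pred (≤∧≢⇒< i₀≤n i₀≢n)) (λ i i≤n → others i (m≤n⇒m≤1+n i≤n)))
                                  (others (suc n) ≤-refl (i₀≢n ∘ sym)))
                       (ℤ.+-identityʳ _)

Σ≤-hom : (_∙_ : ℤ → ℤ → ℤ) → (∀ a b c d → (a ∙ b) +ℤ (c ∙ d) ≡ (a +ℤ c) ∙ (b +ℤ d)) →
         ∀ n (f g : ℕ → ℤ) → Σ≤ n (λ i → f i ∙ g i) ≡ Σ≤ n f ∙ Σ≤ n g
Σ≤-hom _∙_ interchange zero    f g = refl
Σ≤-hom _∙_ interchange (suc n) f g =
  trans (cong (_+ℤ (f (suc n) ∙ g (suc n))) (Σ≤-hom _∙_ interchange n f g))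
        (interchange (Σ≤ n f) (Σ≤ n g) (f (suc n)) (g (suc n)))

Σ≤-delta : ∀ n i (g : ℕ → ℤ) →
  Σ≤ n (λ a → if i ≡ᵇ (n ∸ a) then g a else + 0) ≡ (if i <ᵇ suc n then g (n ∸ i) else + 0)
Σ≤-delta n i g with i <? suc n
... | yes i<1+n rewrite dec-true (i <? suc n) i<1+n = begin
  Σ≤ n (λ a → if i ≡ᵇ (n ∸ a) then g a else + 0)
    ≡⟨ Σ≤-single n (n ∸ i) _ (m∸n≤m n i) off-diagonal ⟩
  (if i ≡ᵇ (n ∸ (n ∸ i)) then g (n ∸ i) else + 0)
    ≡⟨ cong (λ b → if i ≡ᵇ b then g (n ∸ i) else + 0) (m∸[m∸n]≡n (≤-pred i<1+n)) ⟩
  (if i ≡ᵇ i then g (n ∸ i) else + 0)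
    ≡⟨ cong (λ b → if b then g (n ∸ i) else + 0) (dec-true (i ≟ i) refl) ⟩
  g (n ∸ i) ∎
  where
  open ≡-Reasoning
  off-diagonal : ∀ a → a ≤ n → a ≢ n ∸ i → (if i ≡ᵇ (n ∸ a) then g a else + 0) ≡ + 0
  off-diagonal a a≤n a≢ rewrite dec-false (i ≟ (n ∸ a))
    (λ i≡n-a → a≢ (sym (trans (cong (n ∸_) i≡n-a) (m∸[m∸n]≡n a≤n)))) = refl
... | no  i≮1+n rewrite dec-false (i <? suc n) i≮1+n = Σ≤-zero n _ beyond
  where
  beyond : ∀ a → a ≤ n → (if i ≡ᵇ (n ∸ a) then g a else + 0) ≡ + 0
  beyond a a≤n rewrite dec-false (i ≟ (n ∸ a))
    (λ i≡n-a → i≮1+n (s≤s (subst (_≤ n) (sym i≡n-a) (m∸n≤m n a)))) = refl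

-- Multiplication by the monomial x^i y^j.
shift : Series → ℕ → ℕ → Series
shift F zero    zero    n       m       = F n m
shift F zero    (suc j) n       zero    = + 0
shift F zero    (suc j) n       (suc m) = shift F zero j n m
shift F (suc i) j       zero    m       = + 0
shift F (suc i) j       (suc n) m       = shift F i j n m

shift-coefficient : ∀ F i j n m →
  shift F i j n m ≡ (if i <ᵇ suc n then (if j <ᵇ suc m then F (n ∸ i) (m ∸ j) else + 0) else + 0)
shift-coefficient F zero    zero    n       m       = refl
shift-coefficient F zero    (suc j) n       zero    = refl
shift-coefficient F zero    (suc j) n       (suc m) = shift-coefficient F zero j n m
shift-coefficient F (suc i) j       zero    m       = refl
shift-coefficient F (suc i) j       (suc n) m       = shift-coefficient F i j n m

conv-mono : ∀ F i j n m → (F ⊛ mono i j) n m ≡ shift F i j n m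
conv-mono F i j n m = begin
  Σ≤ n (λ a → Σ≤ m (λ b → F a b *ℤ mono i j (n ∸ a) (m ∸ b)))
    ≡⟨ Σ≤-cong n (λ a → trans (Σ≤-cong m (λ b → times-mono (F a b) (n ∸ a) (m ∸ b)))
                              (inner-sum (i ≡ᵇ (n ∸ a)) (F a))) ⟩
  Σ≤ n (λ a → if i ≡ᵇ (n ∸ a) then (if j <ᵇ suc m then F a (m ∸ j) else + 0) else + 0)
    ≡⟨ Σ≤-delta n i (λ a → if j <ᵇ suc m then F a (m ∸ j) else + 0) ⟩
  (if i <ᵇ suc n then (if j <ᵇ suc m then F (n ∸ i) (m ∸ j) else + 0) else + 0)
    ≡⟨ shift-coefficient F i j n m ⟨
  shift F i j n m ∎
  where
  open ≡-Reasoning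
  times-mono : ∀ c x y → c *ℤ mono i j x y ≡ (if i ≡ᵇ x then (if j ≡ᵇ y then c else + 0) else + 0)
  times-mono c x y with i ≡ᵇ x | j ≡ᵇ y
  ... | true  | true  = ℤ.*-identityʳ c
  ... | true  | false = ℤ.*-zeroʳ c
  ... | false | _     = ℤ.*-zeroʳ c
  inner-sum : ∀ b (h : ℕ → ℤ) → Σ≤ m (λ y → if b then (if j ≡ᵇ (m ∸ y) then h y else + 0) else + 0)
                                ≡ (if b then (if j <ᵇ suc m then h (m ∸ j) else + 0) else + 0)
  inner-sum true  h = Σ≤-delta m j h
  inner-sum false h = Σ≤-zero m _ (λ _ _ → refl)

conv-hom : (_∙_ : ℤ → ℤ → ℤ) → (∀ a b c d → (a ∙ b) +ℤ (c ∙ d) ≡ (a +ℤ c) ∙ (b +ℤ d)) →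
  (∀ a b c → a *ℤ (b ∙ c) ≡ (a *ℤ b) ∙ (a *ℤ c)) →
  ∀ F G H n m → (F ⊛ (λ x y → G x y ∙ H x y)) n m ≡ (F ⊛ G) n m ∙ (F ⊛ H) n m
conv-hom _∙_ interchange distrib F G H n m =
  trans (Σ≤-cong n (λ a → trans (Σ≤-cong m (λ b → distrib (F a b) _ _)) (Σ≤-hom _∙_ interchange m _ _)))
        (Σ≤-hom _∙_ interchange n _ _)

conv-⊕ : ∀ F G H n m → (F ⊛ (G ⊕ H)) n m ≡ (F ⊛ G) n m +ℤ (F ⊛ H) n m
conv-⊕ = conv-hom _+ℤ_ solve-∀ solve-∀

conv-⊖ : ∀ F G H n m → (F ⊛ (G ⊖ H)) n m ≡ (F ⊛ G) n m -ℤ (F ⊛ H) n m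
conv-⊖ = conv-hom _-ℤ_ solve-∀ solve-∀

conv-zeroS : ∀ F n m → (F ⊛ zeroS) n m ≡ + 0
conv-zeroS F n m = Σ≤-zero n _ (λ a _ → Σ≤-zero m _ (λ b _ → ℤ.*-zeroʳ (F a b)))

conv-sumS : ∀ F (G : ℕ → Series) j n m → (F ⊛ sumS (applyUpTo G j)) n m ≡ Σℤ< j (λ i → (F ⊛ G i) n m)
conv-sumS F G zero    n m = conv-zeroS F n m
conv-sumS F G (suc j) n m = trans (conv-⊕ F (G 0) (sumS (applyUpTo (G ∘ suc) j)) n m)
                                  (cong (λ s → (F ⊛ G 0) n m +ℤ s) (conv-sumS F (G ∘ suc) j n m))

shift-beyond : ∀ F i j n m → n < i → shift F i j n m ≡ + 0
shift-beyond F (suc i) j zero    m _         = refl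
shift-beyond F (suc i) j (suc n) m (s≤s n<i) = shift-beyond F i j n m n<i

shift-cancel : ∀ F c i j n m → shift F (c + i) j (c + n) m ≡ shift F i j n m
shift-cancel F zero    i j n m = refl
shift-cancel F (suc c) i j n m = shift-cancel F c i j n m

shift-genA-y : ∀ k i n m → shift (genA k) i 1 n m ≡ + (if i <ᵇ suc n then yShift (a k (n ∸ i)) m else 0)
shift-genA-y k zero    n       zero    = refl
shift-genA-y k zero    n       (suc m) = refl
shift-genA-y k (suc i) zero    m       = refl
shift-genA-y k (suc i) (suc n) m       = shift-genA-y k i n m

mono-off : ∀ i j n m → i ≢ n → mono i j n m ≡ + 0
mono-off i j n m i≢n rewrite dec-false (i ≟ n) i≢n = refl

denom-coefficient : ∀ k A n m → (A ⊛ denom k) n m ≡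
  A n m -ℤ shift A 1 0 n m -ℤ shift A k 0 n m -ℤ Σℤ< (k ∸ 1) (λ i → shift A (k + 2 + i) 1 n m)
denom-coefficient k A n m = begin
  (A ⊛ denom k) n m
    ≡⟨ conv-⊖ A (mono 0 0 ⊖ mono 1 0 ⊖ mono k 0) (sumS (map y-term (upTo (k ∸ 1)))) n m ⟩
  (A ⊛ (mono 0 0 ⊖ mono 1 0 ⊖ mono k 0)) n m -ℤ (A ⊛ sumS (map y-term (upTo (k ∸ 1)))) n m
    ≡⟨ cong₂ _-ℤ_ (minus-mono (mono 0 0 ⊖ mono 1 0) k 0) y-terms ⟩
  (A ⊛ (mono 0 0 ⊖ mono 1 0)) n m -ℤ shift A k 0 n m -ℤ Σℤ< (k ∸ 1) (λ i → shift A (k + 2 + i) 1 n m)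
    ≡⟨ cong (λ s → s -ℤ shift A k 0 n m -ℤ Σℤ< (k ∸ 1) (λ i → shift A (k + 2 + i) 1 n m))
            (trans (minus-mono (mono 0 0) 1 0) (cong (_-ℤ shift A 1 0 n m) (conv-mono A 0 0 n m))) ⟩
  A n m -ℤ shift A 1 0 n m -ℤ shift A k 0 n m -ℤ Σℤ< (k ∸ 1) (λ i → shift A (k + 2 + i) 1 n m) ∎
  where
  open ≡-Reasoning
  y-term : ℕ → Series
  y-term i = mono (k + 2 + i) 1
  minus-mono : ∀ G i j → (A ⊛ (G ⊖ mono i j)) n m ≡ (A ⊛ G) n m -ℤ shift A i j n m
  minus-mono G i j = trans (conv-⊖ A G (mono i j) n m) (cong ((A ⊛ G) n m -ℤ_) (conv-mono A i j n m))
  y-terms : (A ⊛ sumS (map y-term (upTo (k ∸ 1)))) n m ≡ Σℤ< (k ∸ 1) (λ i → shift A (k + 2 + i) 1 n m)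
  y-terms = begin
    (A ⊛ sumS (map y-term (upTo (k ∸ 1)))) n m          ≡⟨ cong (λ L → (A ⊛ sumS L) n m) (map-upTo y-term (k ∸ 1)) ⟩
    (A ⊛ sumS (applyUpTo y-term (k ∸ 1))) n m           ≡⟨ conv-sumS A y-term (k ∸ 1) n m ⟩
    Σℤ< (k ∸ 1) (λ i → (A ⊛ y-term i) n m)              ≡⟨ Σℤ<-cong (k ∸ 1) (λ i → conv-mono A (k + 2 + i) 1 n m) ⟩
    Σℤ< (k ∸ 1) (λ i → shift A (k + 2 + i) 1 n m)     ∎

module _ (k₁ : ℕ) where
  private
    k : ℕ
    k = suc k₁
    A : Series
    A = genA k

  D : ℕ → ℕ → ℤ
  D n m = A n m -ℤ shift A 1 0 n m -ℤ shift A k 0 n m -ℤ Σℤ< k₁ (λ i → shift A (k + 2 + i) 1 n m)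

  x^k-coefficient : ∀ d m → shift A k 0 (k + d) m ≡ + a k d m
  x^k-coefficient d m = trans (cong (λ c → shift A c 0 (k + d) m) (sym (+-identityʳ k))) (shift-cancel A k 0 0 d m)

  y-terms-vanish : ∀ n m → n < k + 2 → Σℤ< k₁ (λ i → shift A (k + 2 + i) 1 n m) ≡ + 0
  y-terms-vanish n m n<k+2 = trans (Σℤ<-cong k₁ (λ i → shift-beyond A (k + 2 + i) 1 n m (≤-trans n<k+2 (m≤m+n _ i))))
                                   (Σℤ<-zero k₁)

  -- Degrees 0, …, k - 1: the recurrence a_{n+1} = a_n gives 1 at n = 0 and 0 otherwise.
  coefficient-below : ∀ n m → n < k → D n m ≡ numer k n m
  coefficient-below zero    zero    _ rewrite Σℤ<-zero k₁ = refl
  coefficient-below zero    (suc m) _ rewrite Σℤ<-zero k₁ = refl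
  coefficient-below (suc n) m n<k rewrite a-flat k₁ n m (<⇒≤ n<k) | shift-beyond A k 0 (suc n) m n<k
    | y-terms-vanish (suc n) m (≤-trans n<k (m≤m+n k 2)) | mono-off k 0 (suc n) m (<⇒≢ n<k ∘ sym) = cancel (+ a k n m)
    where
    cancel : ∀ x → x -ℤ x -ℤ + 0 -ℤ + 0 ≡ + 0 -ℤ + 0
    cancel = solve-∀

  -- Degree k: a_k − a_{k-1} − a_0 = −[m = 0], the numerator's −x^k.
  coefficient-at : ∀ m → D k m ≡ numer k k m
  coefficient-at m rewrite a-flat k₁ k₁ m ≤-refl | y-terms-vanish k m (m<m+n k z<s)
    | trans (cong (λ n → shift A k 0 n m) (sym (+-identityʳ k))) (x^k-coefficient 0 m)
    | dec-true (k ≟ k) refl = trans (cancel (+ a k k₁ m) (+ a k 0 m)) (by-m m)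
    where
    cancel : ∀ x y → x -ℤ x -ℤ y -ℤ + 0 ≡ + 0 -ℤ y
    cancel = solve-∀
    by-m : ∀ m → + 0 -ℤ + a k 0 m ≡ + 0 -ℤ (if 0 ≡ᵇ m then + 1 else + 0)
    by-m zero    = refl
    by-m (suc m) = refl

  -- Degrees above k: the recurrence a-step makes the coefficient vanish.
  coefficient-above : ∀ d m → D (k + suc d) m ≡ numer k (k + suc d) m
  coefficient-above d m = begin
    D (k + suc d) m
      ≡⟨ cong₂ (λ x y → A (k + suc d) m -ℤ x -ℤ y -ℤ Σℤ< k₁ (λ i → shift A (k + 2 + i) 1 (k + suc d) m))
               (cong (λ N → + a k N m) (+-suc k₁ d)) (x^k-coefficient (suc d) m) ⟩
    + a k (k + suc d) m -ℤ + a k (k + d) m -ℤ + a k (suc d) m -ℤ Σℤ< k₁ (λ i → shift A (k + 2 + i) 1 (k + suc d) m)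
      ≡⟨ cong₂ (λ x s → + x -ℤ + a k (k + d) m -ℤ + a k (suc d) m -ℤ s) (a-step k₁ d m) y-terms ⟩
    + (a k (k + d) m + a k (suc d) m + Σ< k₁ E) -ℤ + a k (k + d) m -ℤ + a k (suc d) m -ℤ + Σ< k₁ E
      ≡⟨ cancel (a k (k + d) m) (a k (suc d) m) (Σ< k₁ E) ⟩
    + 0 -ℤ + 0
      ≡⟨ cong (+ 0 -ℤ_) (mono-off k 0 (k + suc d) m (<⇒≢ (m<m+n k z<s))) ⟨
    numer k (k + suc d) m ∎
    where
    open ≡-Reasoning
    E : ℕ → ℕ
    E i = if i <ᵇ d then yShift (a k (d ∸ suc i)) m else 0
    y-terms : Σℤ< k₁ (λ i → shift A (k + 2 + i) 1 (k + suc d) m) ≡ + Σ< k₁ E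
    y-terms = trans (Σℤ<-cong k₁ (λ i → trans (cong (λ p → shift A p 1 (k + suc d) m) (+-assoc k 2 i))
                                        (trans (shift-cancel A k (2 + i) 1 (suc d) m) (shift-genA-y k (2 + i) (suc d) m))))
                    (Σℤ<-pos k₁ E)
    cancel : ∀ x y s → + (x + y + s) -ℤ + x -ℤ + y -ℤ + s ≡ + 0 -ℤ + 0
    cancel x y s rewrite ℤ.pos-+ (x + y) s | ℤ.pos-+ x y = solve′ (+ x) (+ y) (+ s)
      where
      solve′ : ∀ x y s → x +ℤ y +ℤ s -ℤ x -ℤ y -ℤ s ≡ + 0 -ℤ + 0
      solve′ = solve-∀

  coefficient : ∀ n m → D n m ≡ numer k n m
  coefficient n m with n <? k
  ... | yes n<k = coefficient-below n m n<k
  ... | no  n≮k = subst (λ n → D n m ≡ numer k n m) (m+[n∸m]≡n (≮⇒≥ n≮k)) (beyond (n ∸ k))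
    where
    beyond : ∀ d → D (k + d) m ≡ numer k (k + d) m
    beyond zero    = subst (λ n → D n m ≡ numer k n m) (sym (+-identityʳ k)) (coefficient-at m)
    beyond (suc d) = coefficient-above d m

proposition5p1 : ∀ (k : ℕ) → 2 ≤ k →
    ∀ (n m : ℕ) → (genA k ⊛ denom k) n m ≡ numer k n m
proposition5p1 zero    ()
proposition5p1 (suc k₁) _ n m = trans (denom-coefficient (suc k₁) (genA (suc k₁)) n m) (coefficient k₁ n m)
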